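{- Let $G=(S,\mathit{Tr},\mathrm{src},\mathrm{tgt},S_0)$ be a transition system with functions $\mathrm{instr}:\mathit{Tr}\to\mathcal{P}(\mathcal{I})$ and $\mathrm{comp}:\mathit{Tr}\to\mathcal{P}(\mathcal{C})$ (with $\mathrm{instr}(t)\neq\emptyset\neq\mathrm{comp}(t)$), together with a relation "instruction $I$ is requested in state $s$". Assume: (a) $\mathcal{I}$ is finite; (b) there is $\mathrm{cmp}:\mathcal{I}\to\mathcal{C}$ with $\mathrm{comp}(t)=\{\mathrm{cmp}(I)\mid I\in\mathrm{instr}(t)\}$ for all $t$; (c) if an instruction $I$ is enabled in a state $s$ then it is requested in $s$; (d) if $I$ is requested in $s$ and $u$ is a transition with $\mathrm{src}(u)=s$ and $\mathrm{cmp}(I)\notin\mathrm{comp}(u)$, then $I$ is requested in $\mathrm{tgt}(u)$. Then $\mathrm{SC}\preceq\mathrm{SWI}$: every SWI-fair path is strongly fair w.r.t. the tasks $\{T_C\mid C\in\mathcal{C}\}$, $T_C=\{t\mid C\in\mathrm{comp}(t)\}$.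
   Context: A transition system is $G=(S,\mathit{Tr},\mathrm{src},\mathrm{tgt},S_0)$ with states, transitions, source/target maps and initial states. A path is an alternating sequence $s_0t_1s_1t_2\cdots$ of states and transitions, starting with a state, infinite or ending with a state, with $\mathrm{src}(t_i)=s_{i-1}$, $\mathrm{tgt}(t_i)=s_i$. A suffix of $s_0t_1s_1\cdots$ is $s_kt_{k+1}s_{k+1}\cdots$ for some $k$. A task $T\subseteq\mathit{Tr}$ is enabled in $s$ if some $t\in T$ has $\mathrm{src}(t)=s$; relentlessly enabled on $\pi$ if every suffix of $\pi$ contains a state where it is enabled; it occurs in $\pi$ if $\pi$ contains a transition of $T$; $\pi$ is strongly fair w.r.t. a task collection if for every suffix $\pi'$ each task relentlessly enabled on $\pi'$ occurs in $\pi'$. An instruction $I$ is enabled in $s$ if some $t$ with $I\in\mathrm{instr}(t)$ has $\mathrm{src}(t)=s$ (in the paper, "requested" means that such a transition is enabled in the local state of component $\mathrm{cmp}(I)$ within $s$). $I$ is perpetually requested on $\pi$ if requested in every state of $\pi$, relentlessly enabled on $\pi$ if every suffix of $\pi$ contains a state in which $I$ is enabled, and occurs in $\pi$ if $\pi$ contains a transition $t$ with $I\in\mathrm{instr}(t)$. A path $\pi$ is SWI-fair (strongly weakly fair of instructions) if for every suffix $\pi'$ of $\pi$, each instruction that is perpetually requested and relentlessly enabled on $\pi'$ occurs in $\pi'$. $H\preceq F$ means every path satisfying $F$ satisfies $H$. -}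

module Defs where

open import Level using (0ℓ)
open import Data.Nat using (ℕ; suc; _≤_; _<_; _≥_)
open import Data.Unit using (⊤)
open import Data.Product using (Σ; ∃; _×_; _,_)
open import Data.List using (List)
open import Data.List.Membership.Propositional using (_∈_)
open import Relation.Binary.PropositionalEquality using (_≡_)
open import Relation.Nullary using (¬_)

record TransitionSystem : Set₁ where
  field
    S   : Set
    Tr  : Set
    src : Tr → S
    tgt : Tr → S
    S₀  : S → Set

-- Length of a path: finite with n transitions (n+1 states), or infinite.
data Len : Set where
  fin : ℕ → Len
  ∞   : Len

StateIdx : Len → ℕ → Set
StateIdx (fin n) i = i ≤ n
StateIdx ∞       i = ⊤

TransIdx : Len → ℕ → Set
TransIdx (fin n) i = i < n
TransIdx ∞       i = ⊤

module _ (G : TransitionSystem) where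
  open TransitionSystem G

  -- A path s₀ t₁ s₁ t₂ ⋯ (finite, ending in a state, or infinite).
  -- Here st i = sᵢ and tr i = t_{i+1}; values outside the valid range are irrelevant.
  record Path : Set where
    field
      len   : Len
      st    : ℕ → S
      tr    : ℕ → Tr
      valid : ∀ i → TransIdx len i → src (tr i) ≡ st i × tgt (tr i) ≡ st (suc i)
  open Path public

  Task : Set₁
  Task = Tr → Set

  EnabledT : Task → S → Set
  EnabledT T s = ∃ λ t → T t × src t ≡ s

  RelEnabledT : Path → ℕ → Task → Set
  RelEnabledT π k T =
    ∀ j → k ≤ j → StateIdx (len π) j →
      ∃ λ i → j ≤ i × StateIdx (len π) i × EnabledT T (st π i)

  OccursT : Path → ℕ → Task → Set
  OccursT π k T = ∃ λ i → k ≤ i × TransIdx (len π) i × T (tr π i)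

  StronglyFair : {X : Set} → (X → Task) → Path → Set
  StronglyFair task π = ∀ k → StateIdx (len π) k → ∀ x →
    RelEnabledT π k (task x) → OccursT π k (task x)

  module Instr {Ins : Set} (instr : Tr → Ins → Set) (requested : Ins → S → Set) where
    taskOf : Ins → Task
    taskOf I t = instr t I

    PerpRequested : Path → ℕ → Ins → Set
    PerpRequested π k I = ∀ i → k ≤ i → StateIdx (len π) i → requested I (st π i)

    SWIFair : Path → Set
    SWIFair π = ∀ k → StateIdx (len π) k → ∀ I →
      PerpRequested π k I → RelEnabledT π k (taskOf I) → OccursT π k (taskOf I)

Finite : Set → Set
Finite A = Σ (List A) λ xs → ∀ a → a ∈ xs

-- Suppose component C is relentlessly enabled from some point on but never moves again.
-- Each C-transition carries an instruction of C, and there are finitely many instructions,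
-- so (classically) one instruction I of C is itself relentlessly enabled. Once I is enabled
-- it is requested, and it stays requested because only C-transitions could withdraw the
-- request. Hence I is perpetually requested and relentlessly enabled on a suffix, and
-- SWI-fairness makes it occur there -- which is a move of C.
module Submission where

open import Defs
open import Level using (0ℓ)
open import Axiom.ExcludedMiddle using (ExcludedMiddle)
open import Axiom.DoubleNegationElimination using (em⇒dne)
open import Data.Product using (∃; _×_; _,_)
open import Function.Bundles using (_⇔_; Equivalence)
open import Relation.Binary.PropositionalEquality using (_≡_; refl; subst)
open import Relation.Nullary using (¬_; yes; no)
open import Data.Nat using (ℕ; suc; _≤_; _≤′_; ≤′-refl; ≤′-step; _⊔_)
open import Data.Nat.Properties using (⊔-lub; m≤m⊔n; m≤n⊔m; ≤-trans; ≤-refl; n≤1+n; ≤⇒≤′; ≤′⇒≤)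
open import Data.Unit using (tt)
open import Data.Empty using (⊥-elim)
open import Data.List using (List; []; _∷_)
open import Data.List.Membership.Propositional using (_∈_)
open import Data.List.Relation.Unary.Any using (here; there)

stateIdx-⊔ : ∀ L {a b} → StateIdx L a → StateIdx L b → StateIdx L (a ⊔ b)
stateIdx-⊔ (fin n) p q = ⊔-lub p q
stateIdx-⊔ ∞       p q = tt

stateIdx-pred : ∀ L {i} → StateIdx L (suc i) → StateIdx L i
stateIdx-pred (fin n) p = ≤-trans (n≤1+n _) p
stateIdx-pred ∞       p = tt

stateIdx-suc⇒transIdx : ∀ L {i} → StateIdx L (suc i) → TransIdx L i
stateIdx-suc⇒transIdx (fin n) p = p
stateIdx-suc⇒transIdx ∞       p = tt

-- RelEnabledT π k T is definitionally Relentless (len π) k (λ i → EnabledT T (st π i)).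
Relentless : Len → ℕ → (ℕ → Set) → Set
Relentless L k P = ∀ j → k ≤ j → StateIdx L j → ∃ λ i → j ≤ i × StateIdx L i × P i

EventuallyNever : Len → ℕ → (ℕ → Set) → Set
EventuallyNever L k P = ∃ λ m → k ≤ m × StateIdx L m × (∀ i → m ≤ i → StateIdx L i → ¬ P i)

module _ {L : Len} {P : ℕ → Set} where

  relentless-map : ∀ {k} {Q : ℕ → Set} → (∀ {i} → P i → Q i) → Relentless L k P → Relentless L k Q
  relentless-map f rel j kj sj with rel j kj sj
  ... | i , ji , si , p = i , ji , si , f p

  relentless-suffix : ∀ {k m} → k ≤ m → Relentless L k P → Relentless L m P
  relentless-suffix km rel j mj = rel j (≤-trans km mj)

  relentless-prefix : ∀ {k m} → StateIdx L m → Relentless L m P → Relentless L k P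
  relentless-prefix {m = m} sm rel j _ sj with rel (j ⊔ m) (m≤n⊔m j m) (stateIdx-⊔ L sj sm)
  ... | i , ji , si , p = i , ≤-trans (m≤m⊔n j m) ji , si , p

  ¬relentless⇒eventuallyNever : ExcludedMiddle 0ℓ → ∀ {k} →
    ¬ Relentless L k P → EventuallyNever L k P
  ¬relentless⇒eventuallyNever em nrel = dne λ nev → nrel λ j kj sj → dne λ nP →
    nev (j , kj , sj , λ i ji si p → nP (i , ji , si , p))
    where dne = em⇒dne em

relentless-∃∈-drop : ∀ {X : Set} {L} (Q : X → ℕ → Set) {x xs m} →
  (∀ i → m ≤ i → StateIdx L i → ¬ Q x i) →
  Relentless L m (λ i → ∃ λ y → y ∈ x ∷ xs × Q y i) → Relentless L m (λ i → ∃ λ y → y ∈ xs × Q y i)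
relentless-∃∈-drop Q never rel j mj sj with rel j mj sj
... | i , ji , si , y , here refl , q = ⊥-elim (never i (≤-trans mj ji) si q)
... | i , ji , si , y , there y∈ , q = i , ji , si , y , y∈ , q

relentless-∃∈ : ExcludedMiddle 0ℓ → ∀ {X : Set} {L} (Q : X → ℕ → Set) (xs : List X) {k} →
  StateIdx L k → Relentless L k (λ i → ∃ λ x → x ∈ xs × Q x i) →
  ∃ λ x → x ∈ xs × Relentless L k (Q x)
relentless-∃∈ em Q [] sk rel with rel _ ≤-refl sk
... | _ , _ , _ , _ , () , _
relentless-∃∈ em {L = L} Q (x ∷ xs) {k} sk rel with em {Relentless L k (Q x)}
... | yes relx = x , here refl , relx
... | no nrelx with ¬relentless⇒eventuallyNever em nrelx
...   | m , km , sm , never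
      with relentless-∃∈ em Q xs sm (relentless-∃∈-drop Q never (relentless-suffix km rel))
...     | y , y∈ , rely = y , there y∈ , relentless-prefix sm rely

relentless-∃ : ExcludedMiddle 0ℓ → ∀ {X : Set} {L} (Q : X → ℕ → Set) → Finite X → ∀ {k} →
  StateIdx L k → Relentless L k (λ i → ∃ λ x → Q x i) → ∃ λ x → Relentless L k (Q x)
relentless-∃ em Q (xs , complete) sk rel
  with relentless-∃∈ em Q xs sk (relentless-map (λ (x , q) → x , complete x , q) rel)
... | x , _ , relx = x , relx

module _ (G : TransitionSystem) where
  open TransitionSystem G

  occurs-prefix : ∀ (π : Path G) {k m} {T : Task G} → k ≤ m → OccursT G π m T → OccursT G π k T
  occurs-prefix π km (i , mi , ti , t) = i , ≤-trans km mi , ti , t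

  Preserved : (S → Set) → Task G → Set
  Preserved R T = ∀ s u → R s → src u ≡ s → ¬ T u → R (tgt u)

  preserved-until-occurs : ∀ (π : Path G) {R : S → Set} {T : Task G} {k} → Preserved R T →
    R (st π k) → ¬ OccursT G π k T → ∀ i → k ≤′ i → StateIdx (len π) i → R (st π i)
  preserved-until-occurs π pres Rk nocc _ ≤′-refl _ = Rk
  preserved-until-occurs π {R} pres Rk nocc (suc i) (≤′-step ki) si
    with stateIdx-suc⇒transIdx (len π) si
  ... | ti with valid π i ti
  ...   | src≡ , tgt≡ = subst R tgt≡ (pres _ _ Ri src≡ λ t → nocc (i , ≤′⇒≤ ki , ti , t))
    where
    Ri = preserved-until-occurs π pres Rk nocc i ki (stateIdx-pred (len π) si)

  occurs-map : ∀ (π : Path G) {k} {T T′ : Task G} → (∀ {t} → T t → T′ t) →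
    OccursT G π k T → OccursT G π k T′
  occurs-map π f (i , ki , ti , t) = i , ki , ti , f t

  enabled⇒instrEnabled : ∀ {Ins Cmp : Set} {instr : Tr → Ins → Set} {comp : Tr → Cmp → Set}
    {cmp : Ins → Cmp} → (∀ t C → comp t C ⇔ (∃ λ I → instr t I × cmp I ≡ C)) →
    ∀ {C s} → EnabledT G (λ t → comp t C) s → ∃ λ I → cmp I ≡ C × EnabledT G (λ t → instr t I) s
  enabled⇒instrEnabled comp⇔ {C} (t , ct , src≡) with Equivalence.to (comp⇔ t C) ct
  ... | I , it , cmpI≡C = I , cmpI≡C , t , it , src≡

proposition7p3 : ExcludedMiddle 0ℓ →
    (G : TransitionSystem) → let open TransitionSystem G in
    (Ins Cmp : Set) (instr : Tr → Ins → Set) (comp : Tr → Cmp → Set)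
    (requested : Ins → S → Set) →
    (∀ t → ∃ λ I → instr t I) → (∀ t → ∃ λ C → comp t C) →
    Finite Ins →
    (cmp : Ins → Cmp) → (∀ t C → comp t C ⇔ (∃ λ I → instr t I × cmp I ≡ C)) →
    (∀ I s → EnabledT G (Instr.taskOf G instr requested I) s → requested I s) →
    (∀ I s u → requested I s → src u ≡ s → ¬ comp u (cmp I) → requested I (tgt u)) →
    (π : Path G) → Instr.SWIFair G instr requested π →
    StronglyFair G (λ C t → comp t C) π
proposition7p3 em G Ins Cmp instr comp requested _ _ finIns cmp comp⇔
  enabled⇒requested request-kept π swi k sk C relC
  with em {OccursT G π k (λ t → comp t C)}
... | yes occ = occ
... | no nocc with relentless-∃ em (λ I i → cmp I ≡ C × EnabledT G (λ t → instr t I) (st π i))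
                     finIns sk (relentless-map (enabled⇒instrEnabled G comp⇔) relC)
...   | I , relI with relI k ≤-refl sk
...     | i₀ , ki₀ , si₀ , cmpI≡C , enI =
  ⊥-elim (noMoveOfC (occurs-map G π {T′ = λ u → comp u C} instrOfC⇒C (swi i₀ si₀ I perp relI₀)))
  where
  open TransitionSystem G
  open Instr G instr requested
  noMoveOfC : ¬ OccursT G π i₀ (λ u → comp u C)
  noMoveOfC occ = nocc (occurs-prefix G π {T = λ u → comp u C} ki₀ occ)
  instrOfC⇒C : ∀ {t} → instr t I → comp t C
  instrOfC⇒C {t} it = Equivalence.from (comp⇔ t C) (I , it , cmpI≡C)
  requestKept : Preserved G (requested I) (λ u → comp u C)
  requestKept s u r src≡ ¬c = request-kept I s u r src≡ (λ c → ¬c (subst (comp u) cmpI≡C c))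
  perp : PerpRequested π i₀ I
  perp i i₀≤i = preserved-until-occurs G π requestKept (enabled⇒requested I _ enI)
    noMoveOfC i (≤⇒≤′ i₀≤i)
  relI₀ : RelEnabledT G π i₀ (taskOf I)
  relI₀ = relentless-map (λ (_ , en) → en) (relentless-suffix ki₀ relI)
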